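{- Let $n\ge 5$ and let $\Gamma$ be the subgraph of $\mathrm{Cay}(\mathrm{Sym}_n,T_n)$ induced on $T_n$. Define $e_l=\{\sigma(l,l+1,l+3),\sigma(l,l+2,l+3)\}$ for $0\le l\le n-3$, and $e_{n-2}=\{\sigma(0,n-2,n-1),\sigma(0,n-2,n)\}$, $e_{n-1}=\{\sigma(1,n-1,n),\sigma(0,1,n-1)\}$, $e_n=\{\sigma(0,2,n),\sigma(1,2,n)\}$. Then $e_0,\dots,e_n$ are pairwise disjoint edges of $\Gamma$, and each $e_m$ is a maximal clique of $\Gamma$ of size $2$ (i.e., no vertex of $\Gamma$ is adjacent to both endpoints of $e_m$).
   Context: $\mathrm{Sym}_n$ is the symmetric group on $[n]$, permutations in one-line notation, $(\pi\circ\rho)(t)=\pi(\rho(t))$. For integers $0\le i<j<k\le n$ the block transposition $\sigma(i,j,k)$ is the permutation $[1\cdots i\ \ j+1\cdots k\ \ i+1\cdots j\ \ k+1\cdots n]$; $T_n$ is the set of all block transpositions. $\mathrm{Cay}(\mathrm{Sym}_n,T_n)$ has vertex set $\mathrm{Sym}_n$, with $\pi\sim\rho$ iff $\rho=\pi\circ\sigma$ for some $\sigma\in T_n$. -}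

module Defs where

open import Data.Nat using (ℕ; zero; suc; _+_; _∸_; _<_; _≤_)
open import Data.Nat.Properties using (_≤?_)
open import Data.List using (List; []; _∷_; _++_; map; upTo)
open import Data.Product using (_×_; _,_; proj₁; proj₂; ∃-syntax)
open import Relation.Binary.PropositionalEquality using (_≡_; _≢_)
open import Relation.Nullary using (yes; no)

-- Permutations of [n] are represented in one-line notation as lists of naturals.

-- the list [a, a+1, ..., b]  (empty when b < a)
interval : ℕ → ℕ → List ℕ
interval a b = map (a +_) (upTo (suc b ∸ a))

σ : ℕ → ℕ → ℕ → ℕ → List ℕ
σ n i j k = interval 1 i ++ interval (suc j) k ++ interval (suc i) j ++ interval (suc k) n

-- 1-based lookup π(t) of a permutation in one-line notation (0 outside range)
at : List ℕ → ℕ → ℕ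
at []       _             = 0
at (x ∷ xs) zero          = 0
at (x ∷ xs) (suc zero)    = x
at (x ∷ xs) (suc (suc t)) = at xs (suc t)

_⊚_ : List ℕ → List ℕ → List ℕ
π ⊚ ρ = map (at π) ρ

InT : ℕ → List ℕ → Set
InT n τ = ∃[ i ] ∃[ j ] ∃[ k ] (i < j × j < k × k ≤ n × τ ≡ σ n i j k)

Adj : ℕ → List ℕ → List ℕ → Set
Adj n π ρ = ∃[ s ] (InT n s × ρ ≡ π ⊚ s)

AdjΓ : ℕ → List ℕ → List ℕ → Set
AdjΓ n π ρ = InT n π × InT n ρ × Adj n π ρ

-- the pairs e_m (meaningful for n ≥ 5 and 0 ≤ m ≤ n)
e : ℕ → ℕ → List ℕ × List ℕ
e n m with suc m ≤? n ∸ 2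
... | yes _ = (σ n m (m + 1) (m + 3) , σ n m (m + 2) (m + 3))       -- 0 ≤ m ≤ n-3
... | no _ with m ∸ (n ∸ 2)
...   | zero        = (σ n 0 (n ∸ 2) (n ∸ 1) , σ n 0 (n ∸ 2) n)     -- m = n-2
...   | suc zero    = (σ n 1 (n ∸ 1) n , σ n 0 1 (n ∸ 1))           -- m = n-1
...   | suc (suc _) = (σ n 0 2 n , σ n 1 2 n)                       -- m = n

Disjoint : List ℕ × List ℕ → List ℕ × List ℕ → Set
Disjoint (a , b) (c , d) = a ≢ c × a ≢ d × b ≢ c × b ≢ d

-- A breakpoint of a word is a pair of neighbours that are not consecutive integers.  Framed by
-- 0 and n + 1, a block transposition of [n] has exactly three breakpoints.  If c ∈ T_n were
-- adjacent to both ends x and y of e_m, then d = c⁻¹, d ∘ x and d ∘ y would all be block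
-- transpositions.  Composing d with x or y on the right rearranges three consecutive blocks of d:
-- it rotates three single letters when m ≤ n - 3, and slides a long block past two letters when
-- m ≥ n - 2.  Only the four junctions around the blocks change, so all three arrangements have
-- the same number of junction breakpoints, and at most three of the four junctions break.  A
-- finite check over the possible bonds y = x + 1 among the at most six letters involved shows
-- that this is impossible.  Disjointness holds because σ(i, j, k) determines (i, j, k), and the
-- triple determines m.

module Submission where

open import Data.Bool using (Bool; true; false; T; not; _∧_; if_then_else_)
open import Data.Bool.Properties using (T-∧)
open import Data.Empty using (⊥)
open import Data.Fin.Subset.Properties using (anySubset?)
open import Data.List using (List; []; _∷_; _++_; map; length; drop; upTo; applyUpTo)
import Data.List.Properties as List
open import Data.List.Relation.Binary.Sublist.Propositional using (_⊆_; []; _∷_; _∷ʳ_; minimum)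
open import Data.List.Relation.Binary.Sublist.Propositional.Properties using (All-resp-⊆; ++⁺)
open import Data.List.Relation.Unary.All using (All; []; _∷_; all?)
open import Data.List.Relation.Unary.AllPairs using ([]; _∷_)
open import Data.List.Relation.Unary.Unique.Propositional using (Unique)
import Data.List.Relation.Unary.Unique.Propositional.Properties as Unique
open import Data.Nat using (ℕ; zero; suc; pred; _+_; _∸_; _<_; _≤_; _≤?_; z≤n; s≤s; _≡ᵇ_)
import Data.Nat.Properties as ℕ
open import Algebra.Properties.CommutativeSemigroup ℕ.+-commutativeSemigroup
  using (x∙yz≈y∙xz; x∙yz≈xz∙y; xy∙z≈xz∙y)
open import Data.Product using (_×_; _,_; proj₁; proj₂; ∃-syntax)
open import Data.Vec using (Vec; []; _∷_)
open import Function.Bundles using (Equivalence)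
open import Relation.Binary.PropositionalEquality
open import Relation.Nullary using (¬_; contradiction; yes; no)
open import Relation.Nullary.Decidable using (Dec; _×-dec_; from-no; T?)

open import Defs

open ≡-Reasoning

range : ℕ → ℕ → List ℕ
range a zero    = []
range a (suc L) = a ∷ range (suc a) L

length-range : ∀ a L → length (range a L) ≡ L
length-range a zero    = refl
length-range a (suc L) = cong suc (length-range (suc a) L)

range-++ : ∀ a L M → range a L ++ range (a + L) M ≡ range a (L + M)
range-++ a zero    M = cong (λ x → range x M) (ℕ.+-identityʳ a)
range-++ a (suc L) M = cong (a ∷_) (begin
  range (suc a) L ++ range (a + suc L) M ≡⟨ cong (λ x → range (suc a) L ++ range x M) (ℕ.+-suc a L) ⟩
  range (suc a) L ++ range (suc a + L) M ≡⟨ range-++ (suc a) L M ⟩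
  range (suc a) (L + M)                  ∎)

range-∷ʳ : ∀ a L → range a L ++ a + L ∷ [] ≡ range a (suc L)
range-∷ʳ a L = trans (range-++ a L 1) (cong (range a) (ℕ.+-comm L 1))

range-split : ∀ a b c d →
  range 1 (a + b + c + d) ≡ range 1 a ++ range (suc a) b ++ range (suc (a + b)) c ++ range (suc (a + b + c)) d
range-split a b c d = begin
  range 1 (a + b + c + d)         ≡⟨ range-++ 1 (a + b + c) d ⟨
  range 1 (a + b + c) ++ R₄       ≡⟨ cong (_++ R₄) (range-++ 1 (a + b) c) ⟨
  (range 1 (a + b) ++ R₃) ++ R₄   ≡⟨ cong (λ X → (X ++ R₃) ++ R₄) (range-++ 1 a b) ⟨
  ((range 1 a ++ R₂) ++ R₃) ++ R₄ ≡⟨ List.++-assoc (range 1 a ++ R₂) R₃ R₄ ⟩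
  (range 1 a ++ R₂) ++ R₃ ++ R₄   ≡⟨ List.++-assoc (range 1 a) R₂ (R₃ ++ R₄) ⟩
  range 1 a ++ R₂ ++ R₃ ++ R₄     ∎
  where
  R₂ R₃ R₄ : List ℕ
  R₂ = range (suc a) b
  R₃ = range (suc (a + b)) c
  R₄ = range (suc (a + b + c)) d

applyUpTo-range : ∀ {f : ℕ → ℕ} a L → (∀ r → f r ≡ a + r) → applyUpTo f L ≡ range a L
applyUpTo-range a zero    f≗a+ = refl
applyUpTo-range a (suc L) f≗a+ =
  cong₂ _∷_ (trans (f≗a+ 0) (ℕ.+-identityʳ a))
            (applyUpTo-range (suc a) L (λ r → trans (f≗a+ (suc r)) (ℕ.+-suc a r)))

upTo-range : ∀ a L → map (a +_) (upTo L) ≡ range a L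
upTo-range a L = trans (List.map-upTo (a +_) L) (applyUpTo-range a L (λ _ → refl))

Unique-range : ∀ a L → Unique (range a L)
Unique-range a L = subst Unique (upTo-range a L) (Unique.map⁺ (ℕ.+-cancelˡ-≡ a _ _) (Unique.upTo⁺ L))

σ-ranges : ∀ n i j k →
  σ n i j k ≡ range 1 i ++ range (suc j) (k ∸ j) ++ range (suc i) (j ∸ i) ++ range (suc k) (n ∸ k)
σ-ranges n i j k =
  cong₂ _++_ (upTo-range 1 i)
    (cong₂ _++_ (upTo-range (suc j) (k ∸ j))
      (cong₂ _++_ (upTo-range (suc i) (j ∸ i)) (upTo-range (suc k) (n ∸ k))))

-- Block transpositions by block lengths

-- σ(a, a + b, a + b + c) in Sym_(a+b+c+d): the adjacent blocks of lengths b and c change places.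
swap : ℕ → ℕ → ℕ → ℕ → List ℕ
swap a b c d = range 1 a ++ range (suc (a + b)) c ++ range (suc a) b ++ range (suc (a + b + c)) d

σ-swap : ∀ i b c d → σ (i + b + c + d) i (i + b) (i + b + c) ≡ swap i b c d
σ-swap i b c d
  rewrite σ-ranges (i + b + c + d) i (i + b) (i + b + c)
        | ℕ.m+n∸m≡n i b | ℕ.m+n∸m≡n (i + b) c | ℕ.m+n∸m≡n (i + b + c) d = refl

σ-swap′ : ∀ {n j k} i b c d → j ≡ i + b → k ≡ i + b + c → n ≡ i + b + c + d → σ n i j k ≡ swap i b c d
σ-swap′ i b c d refl refl refl = σ-swap i b c d

data Cuts : ℕ → ℕ → ℕ → ℕ → Set where
  cuts : ∀ i b c d → 0 < b → 0 < c → Cuts (i + b + c + d) i (i + b) (i + b + c)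

m<m+n⇒0<n : ∀ {m n} → m < m + n → 0 < n
m<m+n⇒0<n {m} {n} m<m+n = ℕ.+-cancelˡ-< m 0 n (subst (_< m + n) (sym (ℕ.+-identityʳ m)) m<m+n)

cuts-view : ∀ {n i j k} → i < j → j < k → k ≤ n → Cuts n i j k
cuts-view {i = i} i<j j<k k≤n
  with b , refl ← ℕ.m≤n⇒∃[o]m+o≡n (ℕ.<⇒≤ i<j)
     | c , refl ← ℕ.m≤n⇒∃[o]m+o≡n (ℕ.<⇒≤ j<k)
     | d , refl ← ℕ.m≤n⇒∃[o]m+o≡n k≤n
  = cuts i b c d (m<m+n⇒0<n i<j) (m<m+n⇒0<n j<k)

data IsBlockTransposition : ℕ → List ℕ → Set where
  swap-form : ∀ a b c d → 0 < b → 0 < c → IsBlockTransposition (a + b + c + d) (swap a b c d)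

InT⇒IsBlockTransposition : ∀ {n τ} → InT n τ → IsBlockTransposition n τ
InT⇒IsBlockTransposition (i , j , k , i<j , j<k , k≤n , refl) with cuts-view i<j j<k k≤n
... | cuts i b c d 0<b 0<c =
  subst (IsBlockTransposition _) (sym (σ-swap i b c d)) (swap-form i b c d 0<b 0<c)

at-zero : ∀ π → at π 0 ≡ 0
at-zero []      = refl
at-zero (_ ∷ _) = refl

at-map : ∀ {f : ℕ → ℕ} → f 0 ≡ 0 → ∀ π t → at (map f π) t ≡ f (at π t)
at-map f0≡0 []      t             = sym f0≡0
at-map f0≡0 (x ∷ π) zero          = sym f0≡0
at-map f0≡0 (x ∷ π) (suc zero)    = refl
at-map f0≡0 (x ∷ π) (suc (suc t)) = at-map f0≡0 π (suc t)

⊚-assoc : ∀ π ρ τ → (π ⊚ ρ) ⊚ τ ≡ π ⊚ (ρ ⊚ τ)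
⊚-assoc π ρ τ = trans (List.map-cong (at-map (at-zero π) ρ) τ) (List.map-∘ τ)

at-shift : ∀ x π a L → map (at (x ∷ π)) (range (suc (suc a)) L) ≡ map (at π) (range (suc a) L)
at-shift x π a zero    = refl
at-shift x π a (suc L) = cong (at π (suc a) ∷_) (at-shift x π (suc a) L)

slice : ∀ A B C → map (at (A ++ B ++ C)) (range (suc (length A)) (length B)) ≡ B
slice (x ∷ A) B       C = trans (at-shift x (A ++ B ++ C) (length A) (length B)) (slice A B C)
slice []      []      C = refl
slice []      (y ∷ B) C = cong (y ∷_) (trans (at-shift y (B ++ C) 0 (length B)) (slice [] B C))

slice′ : ∀ A B C {π s} → π ≡ A ++ B ++ C → s ≡ length A → map (at π) (range (suc s) (length B)) ≡ B
slice′ A B C refl refl = slice A B C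

⊚-swap : ∀ (A B C D : List ℕ) {a b c d} →
  length A ≡ a → length B ≡ b → length C ≡ c → length D ≡ d →
  (A ++ B ++ C ++ D) ⊚ swap a b c d ≡ A ++ C ++ B ++ D
⊚-swap A B C D refl refl refl refl = begin
  map (at π) (R₁ ++ R₂ ++ R₃ ++ R₄)
    ≡⟨ List.map-++ (at π) R₁ _ ⟩
  map (at π) R₁ ++ map (at π) (R₂ ++ R₃ ++ R₄)
    ≡⟨ cong (map (at π) R₁ ++_) (List.map-++ (at π) R₂ _) ⟩
  map (at π) R₁ ++ map (at π) R₂ ++ map (at π) (R₃ ++ R₄)
    ≡⟨ cong (λ X → map (at π) R₁ ++ map (at π) R₂ ++ X) (List.map-++ (at π) R₃ R₄) ⟩
  map (at π) R₁ ++ map (at π) R₂ ++ map (at π) R₃ ++ map (at π) R₄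
    ≡⟨ cong₂ _++_ (slice [] A (B ++ C ++ D)) (cong₂ _++_ C-part (cong₂ _++_ (slice A B (C ++ D)) D-part)) ⟩
  A ++ C ++ B ++ D ∎
  where
  π R₁ R₂ R₃ R₄ : List ℕ
  π  = A ++ B ++ C ++ D
  R₁ = range 1 (length A)
  R₂ = range (suc (length A + length B)) (length C)
  R₃ = range (suc (length A)) (length B)
  R₄ = range (suc (length A + length B + length C)) (length D)
  C-part : map (at π) R₂ ≡ C
  C-part = slice′ (A ++ B) C D (sym (List.++-assoc A B (C ++ D))) (sym (List.length-++ A {B}))
  D-part : map (at π) R₄ ≡ D
  D-part = slice′ ((A ++ B) ++ C) D []
    (sym (begin
      ((A ++ B) ++ C) ++ D ++ [] ≡⟨ cong (((A ++ B) ++ C) ++_) (List.++-identityʳ D) ⟩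
      ((A ++ B) ++ C) ++ D       ≡⟨ List.++-assoc (A ++ B) C D ⟩
      (A ++ B) ++ C ++ D         ≡⟨ List.++-assoc A B (C ++ D) ⟩
      π                          ∎))
    (sym (trans (List.length-++ (A ++ B) {C}) (cong (_+ length C) (List.length-++ A {B}))))

swap-identityˡ : ∀ a b c d → range 1 (a + b + c + d) ⊚ swap a b c d ≡ swap a b c d
swap-identityˡ a b c d =
  trans (cong (_⊚ swap a b c d) (range-split a b c d))
        (⊚-swap (range 1 a) (range (suc a) b) (range (suc (a + b)) c) (range (suc (a + b + c)) d)
                (length-range _ a) (length-range _ b) (length-range _ c) (length-range _ d))

swap-inverse : ∀ a b c d → swap a c b d ⊚ swap a b c d ≡ range 1 (a + c + b + d)
swap-inverse a b c d =
  trans (⊚-swap (range 1 a) (range (suc (a + c)) b) (range (suc a) c) (range (suc (a + c + b)) d)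
                (length-range _ a) (length-range _ b) (length-range _ c) (length-range _ d))
        (sym (range-split a c b d))

+-exchange-middle : ∀ a b c d → a + b + c + d ≡ a + c + b + d
+-exchange-middle a b c d = cong (_+ d) (xy∙z≈xz∙y a b c)

IsBlockTransposition-identityˡ : ∀ {n τ} → IsBlockTransposition n τ → range 1 n ⊚ τ ≡ τ
IsBlockTransposition-identityˡ (swap-form a b c d _ _) = swap-identityˡ a b c d

IsBlockTransposition-length : ∀ {n π} → IsBlockTransposition n π → length π ≡ n
IsBlockTransposition-length (swap-form a b c d _ _) = begin
  length (swap a b c d)                ≡⟨ List.length-map (at (swap a c b d)) (swap a b c d) ⟨
  length (swap a c b d ⊚ swap a b c d) ≡⟨ cong length (swap-inverse a b c d) ⟩
  length (range 1 (a + c + b + d))     ≡⟨ length-range 1 _ ⟩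
  a + c + b + d                        ≡⟨ +-exchange-middle a b c d ⟨
  a + b + c + d                        ∎

inverse : ∀ {n π} → IsBlockTransposition n π → List ℕ
inverse (swap-form a b c d _ _) = swap a c b d

IsBlockTransposition-inverse : ∀ {n π} (p : IsBlockTransposition n π) → IsBlockTransposition n (inverse p)
IsBlockTransposition-inverse (swap-form a b c d 0<b 0<c) =
  subst (λ n → IsBlockTransposition n (swap a c b d)) (sym (+-exchange-middle a b c d)) (swap-form a c b d 0<c 0<b)

inverse-cancelˡ : ∀ {n π τ} (p : IsBlockTransposition n π) → IsBlockTransposition n τ →
                  inverse p ⊚ (π ⊚ τ) ≡ τ
inverse-cancelˡ {τ = τ} (swap-form a b c d _ _) τ-bt = begin
  swap a c b d ⊚ (swap a b c d ⊚ τ) ≡⟨ ⊚-assoc (swap a c b d) (swap a b c d) τ ⟨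
  (swap a c b d ⊚ swap a b c d) ⊚ τ ≡⟨ cong (_⊚ τ) (swap-inverse a b c d) ⟩
  range 1 (a + c + b + d) ⊚ τ       ≡⟨ cong (λ n → range 1 n ⊚ τ) (+-exchange-middle a b c d) ⟨
  range 1 (a + b + c + d) ⊚ τ       ≡⟨ IsBlockTransposition-identityˡ τ-bt ⟩
  τ                                 ∎

-- d stands for the inverse of a common neighbour of x and y.
NoTriangle : ℕ → List ℕ → List ℕ → Set
NoTriangle n x y =
  ∀ {d} → IsBlockTransposition n d → IsBlockTransposition n (d ⊚ x) → IsBlockTransposition n (d ⊚ y) → ⊥

no-common-neighbour : ∀ {n x y} → NoTriangle n x y → (c : List ℕ) → InT n c → ¬ (AdjΓ n c x × AdjΓ n c y)
no-common-neighbour {n} no-triangle c c∈T ((_ , _ , s , s∈T , refl) , (_ , _ , s′ , s′∈T , refl)) =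
  no-triangle (IsBlockTransposition-inverse γ) (undo s∈T) (undo s′∈T)
  where
  γ : IsBlockTransposition n c
  γ = InT⇒IsBlockTransposition c∈T
  undo : ∀ {s} → InT n s → IsBlockTransposition n (inverse γ ⊚ (c ⊚ s))
  undo s∈T = subst (IsBlockTransposition n) (sym (inverse-cancelˡ γ (InT⇒IsBlockTransposition s∈T)))
                   (InT⇒IsBlockTransposition s∈T)

swap-∷ʳ : ∀ a b c d → swap a b c d ++ suc (a + b + c + d) ∷ [] ≡ swap a b c (suc d)
swap-∷ʳ a b c d = begin
  (R₁ ++ R₂ ++ R₃ ++ R₄) ++ N ∷ [] ≡⟨ List.++-assoc R₁ _ _ ⟩
  R₁ ++ (R₂ ++ R₃ ++ R₄) ++ N ∷ [] ≡⟨ cong (R₁ ++_) (List.++-assoc R₂ _ _) ⟩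
  R₁ ++ R₂ ++ (R₃ ++ R₄) ++ N ∷ [] ≡⟨ cong (λ X → R₁ ++ R₂ ++ X) (List.++-assoc R₃ R₄ _) ⟩
  R₁ ++ R₂ ++ R₃ ++ R₄ ++ N ∷ []   ≡⟨ cong (λ X → R₁ ++ R₂ ++ R₃ ++ X) (range-∷ʳ _ d) ⟩
  swap a b c (suc d)               ∎
  where
  N : ℕ
  N  = suc (a + b + c + d)
  R₁ R₂ R₃ R₄ : List ℕ
  R₁ = range 1 a
  R₂ = range (suc (a + b)) c
  R₃ = range (suc a) b
  R₄ = range (suc (a + b + c)) d

framed-unique : ∀ {n π} → IsBlockTransposition n π → Unique (0 ∷ π ++ suc n ∷ [])
framed-unique (swap-form a b c d _ _) = Unique.map⁻ (subst Unique (sym left-inverse) (Unique-range 0 _))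
  where
  ρ : List ℕ
  ρ = swap a c b (suc d)
  left-inverse : map (at ρ) (0 ∷ swap a b c d ++ suc (a + b + c + d) ∷ []) ≡ range 0 (suc (a + c + b + suc d))
  left-inverse = cong₂ _∷_ (at-zero ρ) (trans (cong (ρ ⊚_) (swap-∷ʳ a b c d)) (swap-inverse a b c (suc d)))

-- Breakpoints

bond : ℕ → ℕ → Bool
bond x y = y ≡ᵇ suc x

breaks : ℕ → List ℕ → ℕ
breaks x []       = 0
breaks x (y ∷ ys) = if bond x y then breaks y ys else suc (breaks y ys)

lastOr : ℕ → List ℕ → ℕ
lastOr x []       = x
lastOr x (y ∷ ys) = lastOr y ys

lastOr-∷ʳ : ∀ x xs y → lastOr x (xs ++ y ∷ []) ≡ y
lastOr-∷ʳ x []       y = refl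
lastOr-∷ʳ x (z ∷ zs) y = lastOr-∷ʳ z zs y

≡ᵇ-refl : ∀ x → (x ≡ᵇ x) ≡ true
≡ᵇ-refl zero    = refl
≡ᵇ-refl (suc x) = ≡ᵇ-refl x

bond⇒≡ : ∀ x y → T (bond x y) → y ≡ suc x
bond⇒≡ x y = ℕ.≡ᵇ⇒≡ y (suc x)

breaks-++ : ∀ x ys zs → breaks x (ys ++ zs) ≡ breaks x ys + breaks (lastOr x ys) zs
breaks-++ x []       zs = refl
breaks-++ x (y ∷ ys) zs with bond x y
... | true  = breaks-++ y ys zs
... | false = cong suc (breaks-++ y ys zs)

breaks-range : ∀ x L ys → breaks x (range (suc x) L ++ ys) ≡ breaks (x + L) ys
breaks-range x zero    ys = cong (λ z → breaks z ys) (sym (ℕ.+-identityʳ x))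
breaks-range x (suc L) ys rewrite ≡ᵇ-refl x =
  trans (breaks-range (suc x) L ys) (cong (λ z → breaks z ys) (sym (ℕ.+-suc x L)))

breaks-jump : ∀ {x y} ys → y ≢ suc x → breaks x (y ∷ ys) ≡ suc (breaks y ys)
breaks-jump {x} {y} ys y≢1+x with bond x y in eq
... | true  = contradiction (bond⇒≡ x y (subst T (sym eq) _)) y≢1+x
... | false = refl

swap-breaks : ∀ a b c d → 0 < b → 0 < c → breaks 0 (swap a b c (suc d)) ≡ 3
swap-breaks a (suc b) (suc c) d _ _ = begin
  breaks 0 (range 1 a ++ x ∷ range (suc x) c ++ Y)        ≡⟨ breaks-range 0 a _ ⟩
  breaks a (x ∷ range (suc x) c ++ Y)                     ≡⟨ breaks-jump (range (suc x) c ++ Y) x≢1+a ⟩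
  1 + breaks x (range (suc x) c ++ Y)                     ≡⟨ cong suc (breaks-range x c Y) ⟩
  1 + breaks (x + c) (suc a ∷ range (suc (suc a)) b ++ Z)
    ≡⟨ cong suc (breaks-jump (range (suc (suc a)) b ++ Z) 1+a≢1+x+c) ⟩
  2 + breaks (suc a) (range (suc (suc a)) b ++ Z)         ≡⟨ cong (2 +_) (breaks-range (suc a) b Z) ⟩
  2 + breaks (suc a + b) (z ∷ range (suc z) d)            ≡⟨ cong (2 +_) (breaks-jump (range (suc z) d) z≢2+a+b) ⟩
  3 + breaks z (range (suc z) d)
    ≡⟨ cong (3 +_) (trans (cong (breaks z) (sym (List.++-identityʳ (range (suc z) d)))) (breaks-range z d [])) ⟩
  3                                                       ∎
  where
  x z : ℕ
  x = suc (a + suc b)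
  z = suc (a + suc b + suc c)
  Y Z : List ℕ
  Z = range z (suc d)
  Y = range (suc a) (suc b) ++ Z
  x≢1+a : x ≢ suc a
  x≢1+a = ℕ.>⇒≢ (s≤s (ℕ.m<m+n a (s≤s z≤n)))
  1+a≢1+x+c : suc a ≢ suc (x + c)
  1+a≢1+x+c = ℕ.<⇒≢ (s≤s (ℕ.≤-trans (s≤s (ℕ.m≤m+n a (suc b))) (ℕ.m≤m+n x c)))
  z≢2+a+b : z ≢ suc (suc a + b)
  z≢2+a+b = ℕ.>⇒≢ (s≤s (subst (_< a + suc b + suc c) (ℕ.+-suc a b) (ℕ.m<m+n (a + suc b) (s≤s z≤n))))

framed-breaks : ∀ {n π} → IsBlockTransposition n π → breaks 0 (π ++ suc n ∷ []) ≡ 3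
framed-breaks (swap-form a b c d 0<b 0<c) = trans (cong (breaks 0) (swap-∷ʳ a b c d)) (swap-breaks a b c d 0<b 0<c)

window-breaks : ∀ P X Z →
  breaks 0 (P ++ X ++ Z) ≡ breaks (lastOr 0 P) X + (breaks 0 P + breaks (lastOr (lastOr 0 P) X) Z)
window-breaks P X Z = begin
  breaks 0 (P ++ X ++ Z)                     ≡⟨ breaks-++ 0 P (X ++ Z) ⟩
  breaks 0 P + breaks y₀ (X ++ Z)            ≡⟨ cong (breaks 0 P +_) (breaks-++ y₀ X Z) ⟩
  breaks 0 P + (breaks y₀ X + breaks y₄ Z)   ≡⟨ x∙yz≈y∙xz (breaks 0 P) (breaks y₀ X) _ ⟩
  breaks y₀ X + (breaks 0 P + breaks y₄ Z)   ∎
  where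
  y₀ y₄ : ℕ
  y₀ = lastOr 0 P
  y₄ = lastOr y₀ X

block-breaks : ∀ x X f R Y →
  breaks x (X ++ f ∷ R ++ Y) ≡ (breaks x (X ++ f ∷ []) + breaks (lastOr f R) Y) + breaks f R
block-breaks x X f R Y = begin
  breaks x (X ++ f ∷ R ++ Y)                              ≡⟨ cong (breaks x) (List.++-assoc X (f ∷ []) (R ++ Y)) ⟨
  breaks x ((X ++ f ∷ []) ++ R ++ Y)                      ≡⟨ breaks-++ x (X ++ f ∷ []) (R ++ Y) ⟩
  J₀ + breaks (lastOr x (X ++ f ∷ [])) (R ++ Y)
    ≡⟨ cong (λ y → J₀ + breaks y (R ++ Y)) (lastOr-∷ʳ x X f) ⟩
  J₀ + breaks f (R ++ Y)                                   ≡⟨ cong (J₀ +_) (breaks-++ f R Y) ⟩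
  J₀ + (breaks f R + breaks (lastOr f R) Y)                ≡⟨ x∙yz≈xz∙y J₀ (breaks f R) _ ⟩
  (J₀ + breaks (lastOr f R) Y) + breaks f R                ∎
  where
  J₀ : ℕ
  J₀ = breaks x (X ++ f ∷ [])

same-complement : ∀ {J₁ J₂ K n} → J₁ + K ≡ n → J₂ + K ≡ n → J₁ ≡ J₂
same-complement {J₁} {J₂} {K} e₁ e₂ = ℕ.+-cancelʳ-≡ K J₁ J₂ (trans e₁ (sym e₂))

summand-≤ : ∀ {J K n} → J + K ≡ n → J ≤ n
summand-≤ {J} {K} refl = ℕ.m≤m+n J K

not-both : ∀ {a b} → (T a → T b → ⊥) → T (not (a ∧ b))
not-both {false}         _    = _
not-both {true}  {false} _    = _
not-both {true}  {true}  ¬a∧b = ¬a∧b _ _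

bond-functional : ∀ x {y z} → y ≢ z → T (not (bond x y ∧ bond x z))
bond-functional x {y} {z} y≢z =
  not-both {bond x y} {bond x z} λ xy xz → y≢z (trans (bond⇒≡ x y xy) (sym (bond⇒≡ x z xz)))

bond-injective : ∀ {x y} z → x ≢ y → T (not (bond x z ∧ bond y z))
bond-injective {x} {y} z x≢y =
  not-both {bond x z} {bond y z} λ xz yz → x≢y (ℕ.suc-injective (trans (sym (bond⇒≡ x z xz)) (bond⇒≡ y z yz)))

bond-path₃ : ∀ x y z w → w ≢ 3 + x → T (not (bond x y ∧ bond y z ∧ bond z w))
bond-path₃ x y z w w≢3+x = not-both {bond x y} {bond y z ∧ bond z w} λ xy yzw →
  let yz , zw = Equivalence.to T-∧ yzw
  in w≢3+x (trans (bond⇒≡ z w zw) (cong suc (trans (bond⇒≡ y z yz) (cong suc (bond⇒≡ x y xy)))))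

falses : List Bool → ℕ
falses []       = 0
falses (b ∷ bs) = if b then falses bs else suc (falses bs)

-- bᵢⱼ stands for bond yᵢ yⱼ.  The exclusions hold whenever y₀, …, y₄ are distinct; the three sums
-- count the junction breakpoints of y₀ | y₁ y₂ y₃ | y₄ and of its two rotations.
RotationPattern : Vec Bool 9 → Set
RotationPattern (b01 ∷ b02 ∷ b03 ∷ b12 ∷ b14 ∷ b23 ∷ b24 ∷ b31 ∷ b34 ∷ []) =
  All T ( not (b01 ∧ b02) ∷ not (b01 ∧ b03) ∷ not (b02 ∧ b03) ∷ not (b12 ∧ b14) ∷ not (b23 ∧ b24)
        ∷ not (b31 ∧ b34) ∷ not (b01 ∧ b31) ∷ not (b02 ∧ b12) ∷ not (b03 ∧ b23) ∷ not (b14 ∧ b24)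
        ∷ not (b14 ∧ b34) ∷ not (b24 ∧ b34) ∷ not (b12 ∧ b23 ∧ b31) ∷ [])
  × J₀ ≡ J₁ × J₀ ≡ J₂ × J₀ ≤ 3
  where
  J₀ J₁ J₂ : ℕ
  J₀ = falses (b01 ∷ b12 ∷ b23 ∷ b34 ∷ [])
  J₁ = falses (b02 ∷ b23 ∷ b31 ∷ b14 ∷ [])
  J₂ = falses (b03 ∷ b31 ∷ b12 ∷ b24 ∷ [])

rotationPattern? : ∀ v → Dec (RotationPattern v)
rotationPattern? (_ ∷ _ ∷ _ ∷ _ ∷ _ ∷ _ ∷ _ ∷ _ ∷ _ ∷ []) =
  all? T? _ ×-dec (_ ℕ.≟ _ ×-dec (_ ℕ.≟ _ ×-dec _ ℕ.≤? _))

no-rotationPattern : ∀ v → ¬ RotationPattern v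
no-rotationPattern v p = from-no (anySubset? rotationPattern?) (v , p)

rotation-junctions : ∀ {y₀ y₁ y₂ y₃ y₄} → Unique (y₀ ∷ y₁ ∷ y₂ ∷ y₃ ∷ y₄ ∷ []) →
  let J = λ u v w → breaks y₀ (u ∷ v ∷ w ∷ y₄ ∷ []) in
  J y₁ y₂ y₃ ≡ J y₂ y₃ y₁ → J y₁ y₂ y₃ ≡ J y₃ y₁ y₂ → J y₁ y₂ y₃ ≤ 3 → ⊥
rotation-junctions {y₀} {y₁} {y₂} {y₃} {y₄}
  ((y₀≢y₁ ∷ y₀≢y₂ ∷ y₀≢y₃ ∷ _ ∷ []) ∷ (y₁≢y₂ ∷ y₁≢y₃ ∷ y₁≢y₄ ∷ []) ∷ (y₂≢y₃ ∷ y₂≢y₄ ∷ [])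
    ∷ (y₃≢y₄ ∷ []) ∷ _)
  J₀≡J₁ J₀≡J₂ J₀≤3 =
  no-rotationPattern
    ( bond y₀ y₁ ∷ bond y₀ y₂ ∷ bond y₀ y₃ ∷ bond y₁ y₂ ∷ bond y₁ y₄
    ∷ bond y₂ y₃ ∷ bond y₂ y₄ ∷ bond y₃ y₁ ∷ bond y₃ y₄ ∷ [])
    ( ( bond-functional y₀ y₁≢y₂ ∷ bond-functional y₀ y₁≢y₃ ∷ bond-functional y₀ y₂≢y₃
      ∷ bond-functional y₁ y₂≢y₄ ∷ bond-functional y₂ y₃≢y₄ ∷ bond-functional y₃ y₁≢y₄
      ∷ bond-injective y₁ y₀≢y₃ ∷ bond-injective y₂ y₀≢y₁ ∷ bond-injective y₃ y₀≢y₂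
      ∷ bond-injective y₄ y₁≢y₂ ∷ bond-injective y₄ y₁≢y₃ ∷ bond-injective y₄ y₂≢y₃
      ∷ bond-path₃ y₁ y₂ y₃ y₁ (λ ()) ∷ [])
    , J₀≡J₁ , J₀≡J₂ , J₀≤3)

-- The same for the letters x₀ f l a b N, where f … l is a long block Q: the three sums count the
-- junction breakpoints of x₀ | Q a b | N, x₀ | a Q b | N and x₀ | a b Q | N.  The last exclusion
-- needs N ≠ x₀ + 3 rather than distinctness.
SlidePattern : Vec Bool 9 → Set
SlidePattern (b0f ∷ b0a ∷ bla ∷ blb ∷ blN ∷ baf ∷ bab ∷ bbf ∷ bbN ∷ []) =
  All T ( not (b0f ∧ b0a) ∷ not (bla ∧ blb) ∷ not (bla ∧ blN) ∷ not (blb ∧ blN) ∷ not (baf ∧ bab)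
        ∷ not (bbf ∧ bbN) ∷ not (b0f ∧ baf) ∷ not (b0f ∧ bbf) ∷ not (b0a ∧ bla) ∷ not (blb ∧ bab)
        ∷ not (baf ∧ bbf) ∷ not (blN ∧ bbN) ∷ not (b0a ∧ bab ∧ bbN) ∷ [])
  × J₀ ≡ J₁ × J₀ ≡ J₂ × J₀ ≤ 3
  where
  J₀ J₁ J₂ : ℕ
  J₀ = falses (b0f ∷ []) + falses (bla ∷ bab ∷ bbN ∷ [])
  J₁ = falses (b0a ∷ baf ∷ []) + falses (blb ∷ bbN ∷ [])
  J₂ = falses (b0a ∷ bab ∷ bbf ∷ []) + falses (blN ∷ [])

slidePattern? : ∀ v → Dec (SlidePattern v)
slidePattern? (_ ∷ _ ∷ _ ∷ _ ∷ _ ∷ _ ∷ _ ∷ _ ∷ _ ∷ []) =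
  all? T? _ ×-dec (_ ℕ.≟ _ ×-dec (_ ℕ.≟ _ ×-dec _ ℕ.≤? _))

no-slidePattern : ∀ v → ¬ SlidePattern v
no-slidePattern v p = from-no (anySubset? slidePattern?) (v , p)

slide-junctions : ∀ {x₀ f l a b N} → Unique (x₀ ∷ f ∷ l ∷ a ∷ b ∷ N ∷ []) → N ≢ 3 + x₀ →
  let J = λ X Y → breaks x₀ (X ++ f ∷ []) + breaks l Y in
  J [] (a ∷ b ∷ N ∷ []) ≡ J (a ∷ []) (b ∷ N ∷ []) →
  J [] (a ∷ b ∷ N ∷ []) ≡ J (a ∷ b ∷ []) (N ∷ []) →
  J [] (a ∷ b ∷ N ∷ []) ≤ 3 → ⊥
slide-junctions {x₀} {f} {l} {a} {b} {N}
  ((_ ∷ x₀≢l ∷ x₀≢a ∷ x₀≢b ∷ _ ∷ []) ∷ (_ ∷ f≢a ∷ f≢b ∷ f≢N ∷ [])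
    ∷ (l≢a ∷ l≢b ∷ _ ∷ []) ∷ (a≢b ∷ a≢N ∷ []) ∷ (b≢N ∷ []) ∷ _)
  N≢3+x₀ J₀≡J₁ J₀≡J₂ J₀≤3 =
  no-slidePattern
    ( bond x₀ f ∷ bond x₀ a ∷ bond l a ∷ bond l b ∷ bond l N
    ∷ bond a f ∷ bond a b ∷ bond b f ∷ bond b N ∷ [])
    ( ( bond-functional x₀ f≢a ∷ bond-functional l a≢b ∷ bond-functional l a≢N
      ∷ bond-functional l b≢N ∷ bond-functional a f≢b ∷ bond-functional b f≢N
      ∷ bond-injective f x₀≢a ∷ bond-injective f x₀≢b ∷ bond-injective a x₀≢l
      ∷ bond-injective b l≢a ∷ bond-injective f a≢b ∷ bond-injective N l≢b
      ∷ bond-path₃ x₀ a b N N≢3+x₀ ∷ [])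
    , J₀≡J₁ , J₀≡J₂ , J₀≤3)

-- Three consecutive blocks cannot be rearranged twice within T_n

Unique-resp-⊆ : ∀ {xs ys : List ℕ} → xs ⊆ ys → Unique ys → Unique xs
Unique-resp-⊆ []             []         = []
Unique-resp-⊆ (_ ∷ʳ xs⊆ys)   (_ ∷ u)    = Unique-resp-⊆ xs⊆ys u
Unique-resp-⊆ (refl ∷ xs⊆ys) (y∉ys ∷ u) = All-resp-⊆ xs⊆ys y∉ys ∷ Unique-resp-⊆ xs⊆ys u

lastOr-⊆ : ∀ x xs → lastOr x xs ∷ [] ⊆ x ∷ xs
lastOr-⊆ x []       = refl ∷ []
lastOr-⊆ x (y ∷ ys) = x ∷ʳ lastOr-⊆ y ys

∷ʳ-uncons : ∀ (S : List ℕ) x → ∃[ y ] ∃[ Z ] S ++ x ∷ [] ≡ y ∷ Z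
∷ʳ-uncons []      x = x , [] , refl
∷ʳ-uncons (s ∷ S) x = s , S ++ x ∷ [] , refl

rotation-impossible : ∀ {n} P y₁ y₂ y₃ S →
  IsBlockTransposition n (P ++ y₁ ∷ y₂ ∷ y₃ ∷ S) →
  IsBlockTransposition n (P ++ y₂ ∷ y₃ ∷ y₁ ∷ S) →
  IsBlockTransposition n (P ++ y₃ ∷ y₁ ∷ y₂ ∷ S) → ⊥
rotation-impossible {n} P y₁ y₂ y₃ S τ₁ τ₂ τ₃ with ∷ʳ-uncons S (suc n)
... | y₄ , Z , S∷ʳN≡ =
  rotation-junctions distinct (same-complement (count τ₁) (count τ₂)) (same-complement (count τ₁) (count τ₃))
                     (summand-≤ (count τ₁))
  where
  y₀ : ℕ
  y₀ = lastOr 0 P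
  framed : ∀ u v w → (P ++ u ∷ v ∷ w ∷ S) ++ suc n ∷ [] ≡ P ++ (u ∷ v ∷ w ∷ y₄ ∷ []) ++ Z
  framed u v w = trans (List.++-assoc P (u ∷ v ∷ w ∷ S) _) (cong (λ X → P ++ u ∷ v ∷ w ∷ X) S∷ʳN≡)
  count : ∀ {u v w} → IsBlockTransposition n (P ++ u ∷ v ∷ w ∷ S) →
          breaks y₀ (u ∷ v ∷ w ∷ y₄ ∷ []) + (breaks 0 P + breaks y₄ Z) ≡ 3
  count {u} {v} {w} τ =
    trans (sym (window-breaks P (u ∷ v ∷ w ∷ y₄ ∷ []) Z))
          (trans (cong (breaks 0) (sym (framed u v w))) (framed-breaks τ))
  distinct : Unique (y₀ ∷ y₁ ∷ y₂ ∷ y₃ ∷ y₄ ∷ [])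
  distinct = Unique-resp-⊆ (++⁺ (lastOr-⊆ 0 P) (refl ∷ refl ∷ refl ∷ refl ∷ minimum Z))
                           (subst (λ W → Unique (0 ∷ W)) (framed y₁ y₂ y₃) (framed-unique τ₁))

slide-impossible : ∀ {n} Q a b → 2 ≤ length Q →
  IsBlockTransposition n (Q ++ a ∷ b ∷ []) →
  IsBlockTransposition n (a ∷ Q ++ b ∷ []) →
  IsBlockTransposition n (a ∷ b ∷ Q) → ⊥
slide-impossible (_ ∷ []) _ _ (s≤s ())
slide-impossible {n} (f ∷ r ∷ R) a b _ τ₁ τ₂ τ₃ =
  slide-junctions distinct N≢3 (same-complement (count [] _ framed₁ τ₁) (count (a ∷ []) _ framed₂ τ₂))
                               (same-complement (count [] _ framed₁ τ₁) (count (a ∷ b ∷ []) _ refl τ₃))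
                               (summand-≤ (count [] _ framed₁ τ₁))
  where
  N : ℕ
  N = suc n
  count : ∀ {π} X Y → π ++ N ∷ [] ≡ X ++ f ∷ (r ∷ R) ++ Y → IsBlockTransposition n π →
          (breaks 0 (X ++ f ∷ []) + breaks (lastOr r R) Y) + breaks f (r ∷ R) ≡ 3
  count X Y eq τ = trans (sym (block-breaks 0 X f (r ∷ R) Y)) (trans (cong (breaks 0) (sym eq)) (framed-breaks τ))
  framed₁ : (f ∷ r ∷ R ++ a ∷ b ∷ []) ++ N ∷ [] ≡ f ∷ (r ∷ R) ++ a ∷ b ∷ N ∷ []
  framed₁ = cong (f ∷_) (List.++-assoc (r ∷ R) (a ∷ b ∷ []) (N ∷ []))
  framed₂ : (a ∷ f ∷ r ∷ R ++ b ∷ []) ++ N ∷ [] ≡ a ∷ f ∷ (r ∷ R) ++ b ∷ N ∷ []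
  framed₂ = cong (λ X → a ∷ f ∷ X) (List.++-assoc (r ∷ R) (b ∷ []) (N ∷ []))
  distinct : Unique (0 ∷ f ∷ lastOr r R ∷ a ∷ b ∷ N ∷ [])
  distinct = Unique-resp-⊆ (refl ∷ refl ∷ ++⁺ (lastOr-⊆ r R) (refl ∷ refl ∷ refl ∷ []))
                           (subst (λ W → Unique (0 ∷ W)) framed₁ (framed-unique τ₁))
  N≢3 : N ≢ 3
  N≢3 N≡3 = ℕ.1+n≢0 (trans (sym (List.length-++-sucʳ R a (b ∷ [])))
    (ℕ.suc-injective (ℕ.suc-injective (trans (IsBlockTransposition-length τ₁) (ℕ.suc-injective N≡3)))))

-- Reading (i, j, k) off σ(i, j, k)

run : ℕ → List ℕ → ℕ
run a []       = 0
run a (x ∷ xs) = if x ≡ᵇ a then suc (run (suc a) xs) else 0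

-- σ(i, j, k) starts with the run 1, …, i, followed by the run j + 1, …, k.
decode : List ℕ → ℕ × ℕ × ℕ
decode π = i , j , j + run (suc j) (drop i π)
  where
  i j : ℕ
  i = run 1 π
  j = pred (at π (suc i))

decode-≡ : ∀ {π i j c} → run 1 π ≡ i → at π (suc i) ≡ suc j → run (suc j) (drop i π) ≡ c →
           decode π ≡ (i , j , j + c)
decode-≡ refl eⱼ e꜀ rewrite eⱼ | e꜀ = refl

run-range : ∀ a L {x} xs → x ≢ a + L → run a (range a L ++ x ∷ xs) ≡ L
run-range a zero {x} xs x≢a+0 with x ≡ᵇ a in eq
... | true  = contradiction (trans (ℕ.≡ᵇ⇒≡ x a (subst T (sym eq) _)) (sym (ℕ.+-identityʳ a))) x≢a+0
... | false = refl
run-range a (suc L) xs x≢a+1+L rewrite ≡ᵇ-refl a =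
  cong suc (run-range (suc a) L xs (λ x≡ → x≢a+1+L (trans x≡ (sym (ℕ.+-suc a L)))))

at-++-∷ : ∀ A x xs → at (A ++ x ∷ xs) (suc (length A)) ≡ x
at-++-∷ []          x xs = refl
at-++-∷ (y ∷ [])    x xs = refl
at-++-∷ (y ∷ z ∷ A) x xs = at-++-∷ (z ∷ A) x xs

drop-++ : ∀ (A B : List ℕ) → drop (length A) (A ++ B) ≡ B
drop-++ []      B = refl
drop-++ (x ∷ A) B = drop-++ A B

decode-swap : ∀ a b c d → 0 < b → 0 < c → decode (swap a b c d) ≡ (a , a + b , a + b + c)
decode-swap a (suc b) (suc c) d _ _ = decode-≡ prefix entry block
  where
  x : ℕ
  x = suc (a + suc b)
  R : List ℕ
  R = range (suc a) (suc b) ++ range (suc (a + suc b + suc c)) d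
  prefix : run 1 (range 1 a ++ x ∷ range (suc x) c ++ R) ≡ a
  prefix = run-range 1 a _ (ℕ.>⇒≢ (s≤s (ℕ.m<m+n a (s≤s z≤n))))
  entry : at (range 1 a ++ x ∷ range (suc x) c ++ R) (suc a) ≡ x
  entry = subst (λ i → at (range 1 a ++ x ∷ range (suc x) c ++ R) (suc i) ≡ x) (length-range 1 a)
                (at-++-∷ (range 1 a) x _)
  1+a≢x+c : suc a ≢ x + suc c
  1+a≢x+c = ℕ.<⇒≢ (s≤s (ℕ.≤-trans (ℕ.m<m+n a (s≤s z≤n)) (ℕ.m≤m+n (a + suc b) (suc c))))
  block : run x (drop a (range 1 a ++ range x (suc c) ++ R)) ≡ suc c
  block = trans (cong (λ i → run x (drop i (range 1 a ++ range x (suc c) ++ R))) (sym (length-range 1 a)))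
            (trans (cong (run x) (drop-++ (range 1 a) _)) (run-range x (suc c) _ 1+a≢x+c))

decode-σ : ∀ {n i j k} → i < j → j < k → k ≤ n → decode (σ n i j k) ≡ (i , j , k)
decode-σ i<j j<k k≤n with cuts-view i<j j<k k≤n
... | cuts i b c d 0<b 0<c = trans (cong decode (σ-swap i b c d)) (decode-swap i b c d 0<b 0<c)

MaximalEdge : ℕ → List ℕ × List ℕ → Set
MaximalEdge n p =
  AdjΓ n (proj₁ p) (proj₂ p) × ((c : List ℕ) → InT n c → ¬ (AdjΓ n c (proj₁ p) × AdjΓ n c (proj₂ p)))

-- For n ≥ 5, the index m of the pair e_m that contains σ(i, j, k).
edgeIndex : ℕ → ℕ × ℕ × ℕ → ℕ
edgeIndex n (i , j , k) =
  if k ≡ᵇ i + 3 then i else if j ≡ᵇ 1 then n ∸ 1 else if j ≡ᵇ 2 then n else if i ≡ᵇ 0 then n ∸ 2 else n ∸ 1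

Indexed : ℕ → ℕ → List ℕ × List ℕ → Set
Indexed n m p = edgeIndex n (decode (proj₁ p)) ≡ m × edgeIndex n (decode (proj₂ p)) ≡ m

EdgeFacts : ℕ → ℕ → List ℕ × List ℕ → Set
EdgeFacts n m p = MaximalEdge n p × Indexed n m p

σ∈T : ∀ {n i j k} → i < j → j < k → k ≤ n → InT n (σ n i j k)
σ∈T i<j j<k k≤n = _ , _ , _ , i<j , j<k , k≤n , refl

split-at : ∀ m (xs : List ℕ) {k} → length xs ≡ m + k →
           ∃[ ys ] ∃[ zs ] xs ≡ ys ++ zs × length ys ≡ m × length zs ≡ k
split-at zero    xs       eq = [] , xs , refl , refl , eq
split-at (suc m) (x ∷ xs) eq with split-at m xs (ℕ.suc-injective eq)
... | ys , zs , refl , refl , |zs| = x ∷ ys , zs , refl , refl , |zs|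

module Local (m t : ℕ) where

  n : ℕ
  n = m + 3 + t

  τ₁ τ₂ : List ℕ
  τ₁ = σ n m (m + 1) (m + 3)
  τ₂ = σ n m (m + 2) (m + 3)

  τ₁≡ : τ₁ ≡ swap m 1 2 t
  τ₁≡ = σ-swap′ m 1 2 t refl (sym (ℕ.+-assoc m 1 2)) (cong (_+ t) (sym (ℕ.+-assoc m 1 2)))

  τ₂≡ : τ₂ ≡ swap m 2 1 t
  τ₂≡ = σ-swap′ m 2 1 t refl (sym (ℕ.+-assoc m 2 1)) (cong (_+ t) (sym (ℕ.+-assoc m 2 1)))

  m<m+1 : m < m + 1
  m<m+1 = ℕ.m<m+n m (s≤s z≤n)
  m<m+2 : m < m + 2
  m<m+2 = ℕ.m<m+n m (s≤s z≤n)
  m+1<m+3 : m + 1 < m + 3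
  m+1<m+3 = ℕ.+-monoʳ-< m (s≤s (s≤s z≤n))
  m+2<m+3 : m + 2 < m + 3
  m+2<m+3 = ℕ.+-monoʳ-< m (s≤s (s≤s (s≤s z≤n)))
  m+3≤n : m + 3 ≤ n
  m+3≤n = ℕ.m≤m+n (m + 3) t

  τ₁∈T : InT n τ₁
  τ₁∈T = σ∈T m<m+1 m+1<m+3 m+3≤n

  τ₂≡τ₁⊚τ₁ : τ₂ ≡ τ₁ ⊚ τ₁
  τ₂≡τ₁⊚τ₁ = begin
    τ₂ ≡⟨ τ₂≡ ⟩
    range 1 m ++ suc (m + 2) ∷ suc m ∷ suc (suc m) ∷ range (suc (m + 2 + 1)) t
      ≡⟨ cong₂ (λ u R → range 1 m ++ suc u ∷ suc m ∷ R) (ℕ.+-suc m 1)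
               (cong₂ (λ v z → suc v ∷ range (suc z) t) (sym (ℕ.+-comm m 1))
                      (trans (ℕ.+-assoc m 2 1) (sym (ℕ.+-assoc m 1 2)))) ⟩
    range 1 m ++ suc (suc (m + 1)) ∷ suc m ∷ suc (m + 1) ∷ range (suc (m + 1 + 2)) t
      ≡⟨ ⊚-swap (range 1 m) (suc (m + 1) ∷ []) (suc (suc (m + 1)) ∷ suc m ∷ []) (range _ t)
                (length-range 1 m) refl refl (length-range _ t) ⟨
    swap m 1 2 t ⊚ swap m 1 2 t ≡⟨ cong₂ _⊚_ τ₁≡ τ₁≡ ⟨
    τ₁ ⊚ τ₁ ∎

  no-triangle : NoTriangle n τ₁ τ₂
  no-triangle {d} δ δ₁ δ₂ with split-at m d (trans (IsBlockTransposition-length δ) (ℕ.+-assoc m 3 t))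
  ... | P , y₁ ∷ y₂ ∷ y₃ ∷ S , refl , |P| , |S| =
    rotation-impossible P y₁ y₂ y₃ S δ
      (subst (IsBlockTransposition n) (trans (cong ((P ++ y₁ ∷ y₂ ∷ y₃ ∷ S) ⊚_) τ₁≡)
        (⊚-swap P (y₁ ∷ []) (y₂ ∷ y₃ ∷ []) S |P| refl refl |S|′)) δ₁)
      (subst (IsBlockTransposition n) (trans (cong ((P ++ y₁ ∷ y₂ ∷ y₃ ∷ S) ⊚_) τ₂≡)
        (⊚-swap P (y₁ ∷ y₂ ∷ []) (y₃ ∷ []) S |P| refl refl |S|′)) δ₂)
    where
    |S|′ : length S ≡ t
    |S|′ = ℕ.suc-injective (ℕ.suc-injective (ℕ.suc-injective |S|))
  ... | _ , []         , _ , _ , ()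
  ... | _ , _ ∷ []     , _ , _ , ()
  ... | _ , _ ∷ _ ∷ [] , _ , _ , ()

  indexed : Indexed n m (τ₁ , τ₂)
  indexed = trans (cong (edgeIndex n) (decode-σ m<m+1 m+1<m+3 m+3≤n)) (index (m + 1))
          , trans (cong (edgeIndex n) (decode-σ m<m+2 m+2<m+3 m+3≤n)) (index (m + 2))
    where
    index : ∀ j → edgeIndex n (m , j , m + 3) ≡ m
    index j rewrite ≡ᵇ-refl (m + 3) = refl

  facts : EdgeFacts n m (τ₁ , τ₂)
  facts = ((τ₁∈T , σ∈T m<m+2 m+2<m+3 m+3≤n , τ₁ , τ₁∈T , τ₂≡τ₁⊚τ₁) , no-common-neighbour no-triangle)
        , indexed

-- For n = 5 + w: e_(n-2) = (τA , τB), e_(n-1) = (τC , τD) and e_n = (τE , τF).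
module End (w : ℕ) where

  k n : ℕ
  k = 3 + w
  n = 2 + k

  suc≡+1 : ∀ x → suc x ≡ x + 1
  suc≡+1 x = sym (ℕ.+-comm x 1)

  ≡+0 : ∀ x → x ≡ x + 0
  ≡+0 x = sym (ℕ.+-identityʳ x)

  τA τB τC τD τE τF : List ℕ
  τA = σ n 0 k (suc k)
  τB = σ n 0 k n
  τC = σ n 1 (suc k) n
  τD = σ n 0 1 (suc k)
  τE = σ n 0 2 n
  τF = σ n 1 2 n

  τA≡ : τA ≡ swap 0 k 1 1
  τA≡ = σ-swap′ 0 k 1 1 refl (suc≡+1 k) (trans (suc≡+1 (suc k)) (cong (_+ 1) (suc≡+1 k)))
  τB≡ : τB ≡ swap 0 k 2 0
  τB≡ = σ-swap′ 0 k 2 0 refl (sym (ℕ.+-comm k 2)) (trans (sym (ℕ.+-comm k 2)) (≡+0 (k + 2)))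
  τC≡ : τC ≡ swap 1 k 1 0
  τC≡ = σ-swap′ 1 k 1 0 refl (suc≡+1 (suc k)) (trans (suc≡+1 (suc k)) (≡+0 (suc k + 1)))
  τD≡ : τD ≡ swap 0 1 k 1
  τD≡ = σ-swap′ 0 1 k 1 refl refl (suc≡+1 (suc k))
  τE≡ : τE ≡ swap 0 2 k 0
  τE≡ = σ-swap′ 0 2 k 0 refl refl (≡+0 n)
  τF≡ : τF ≡ swap 1 1 k 0
  τF≡ = σ-swap′ 1 1 k 0 refl refl (≡+0 n)

  0<1 : 0 < 1
  0<1 = s≤s z≤n
  0<2 : 0 < 2
  0<2 = s≤s z≤n
  0<k : 0 < k
  0<k = s≤s z≤n
  1<2 : 1 < 2
  1<2 = s≤s (s≤s z≤n)
  1<1+k : 1 < suc k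
  1<1+k = s≤s (s≤s z≤n)
  2<n : 2 < n
  2<n = s≤s (s≤s (s≤s z≤n))
  k<1+k : k < suc k
  k<1+k = ℕ.n<1+n k
  k<n : k < n
  k<n = ℕ.n≤1+n (suc k)
  1+k<n : suc k < n
  1+k<n = ℕ.n<1+n (suc k)
  1+k≤n : suc k ≤ n
  1+k≤n = ℕ.n≤1+n (suc k)

  τA∈T : InT n τA
  τA∈T = σ∈T 0<k k<1+k 1+k≤n
  τB∈T : InT n τB
  τB∈T = σ∈T 0<k k<n ℕ.≤-refl
  τC∈T : InT n τC
  τC∈T = σ∈T 1<1+k 1+k<n ℕ.≤-refl
  τD∈T : InT n τD
  τD∈T = σ∈T 0<1 1<1+k 1+k≤n
  τE∈T : InT n τE
  τE∈T = σ∈T 0<2 2<n ℕ.≤-refl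
  τF∈T : InT n τF
  τF∈T = σ∈T 1<2 2<n ℕ.≤-refl

  τB≡τA⊚τC : τB ≡ τA ⊚ τC
  τB≡τA⊚τC = begin
    τB                                    ≡⟨ τB≡ ⟩
    suc k ∷ suc (suc k) ∷ range 1 k ++ [] ≡⟨ cong (λ x → suc k ∷ suc x ∷ range 1 k ++ []) (suc≡+1 k) ⟩
    suc k ∷ suc (k + 1) ∷ range 1 k ++ []
      ≡⟨ ⊚-swap (suc k ∷ []) (range 1 k) (suc (k + 1) ∷ []) [] refl (length-range 1 k) refl refl ⟨
    swap 0 k 1 1 ⊚ swap 1 k 1 0           ≡⟨ cong₂ _⊚_ τA≡ τC≡ ⟨
    τA ⊚ τC                               ∎

  τD≡τC⊚τE : τD ≡ τC ⊚ τE
  τD≡τC⊚τE = begin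
    τD                          ≡⟨ τD≡ ⟩
    range 2 k ++ 1 ∷ n ∷ []     ≡⟨ ⊚-swap [] (1 ∷ n ∷ []) (range 2 k) [] refl refl (length-range 2 k) refl ⟨
    swap 1 k 1 0 ⊚ swap 0 2 k 0 ≡⟨ cong₂ _⊚_ τC≡ τE≡ ⟨
    τC ⊚ τE                     ∎

  τF≡τE⊚τA : τF ≡ τE ⊚ τA
  τF≡τE⊚τA = begin
    τF                          ≡⟨ τF≡ ⟩
    1 ∷ range 3 k ++ 2 ∷ []     ≡⟨ ⊚-swap [] (range 3 k) (1 ∷ []) (2 ∷ []) refl (length-range 3 k) refl refl ⟨
    swap 0 2 k 0 ⊚ swap 0 k 1 1 ≡⟨ cong₂ _⊚_ τE≡ τA≡ ⟨
    τE ⊚ τA                     ∎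

  2≤k : ∀ (Q : List ℕ) → length Q ≡ k → 2 ≤ length Q
  2≤k Q |Q| = subst (2 ≤_) (sym |Q|) (s≤s (s≤s z≤n))

  no-triangle-AB : NoTriangle n τA τB
  no-triangle-AB {d} δ δ₁ δ₂ with split-at k d (trans (IsBlockTransposition-length δ) (sym (ℕ.+-comm k 2)))
  ... | Q , a ∷ b ∷ [] , refl , |Q| , _ =
    slide-impossible Q a b (2≤k Q |Q|) δ
      (subst (IsBlockTransposition n) (trans (cong ((Q ++ a ∷ b ∷ []) ⊚_) τA≡)
        (⊚-swap [] Q (a ∷ []) (b ∷ []) refl |Q| refl refl)) δ₁)
      (subst (IsBlockTransposition n) (trans (cong ((Q ++ a ∷ b ∷ []) ⊚_) τB≡)
        (trans (⊚-swap [] Q (a ∷ b ∷ []) [] refl |Q| refl refl)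
               (cong (λ X → a ∷ b ∷ X) (List.++-identityʳ Q)))) δ₂)
  ... | _ , []            , _ , _ , ()
  ... | _ , _ ∷ []        , _ , _ , ()
  ... | _ , _ ∷ _ ∷ _ ∷ _ , _ , _ , ()

  no-triangle-CD : NoTriangle n τC τD
  no-triangle-CD {[]} δ with IsBlockTransposition-length δ
  ... | ()
  no-triangle-CD {a ∷ d} δ δ₁ δ₂
    with split-at k d (trans (ℕ.suc-injective (IsBlockTransposition-length δ)) (suc≡+1 k))
  ... | Q , b ∷ [] , refl , |Q| , _ =
    slide-impossible Q a b (2≤k Q |Q|)
      (subst (IsBlockTransposition n) (trans (cong ((a ∷ Q ++ b ∷ []) ⊚_) τD≡)
        (⊚-swap [] (a ∷ []) Q (b ∷ []) refl refl |Q| refl)) δ₂)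
      δ
      (subst (IsBlockTransposition n) (trans (cong ((a ∷ Q ++ b ∷ []) ⊚_) τC≡)
        (trans (⊚-swap (a ∷ []) Q (b ∷ []) [] refl |Q| refl refl)
               (cong (λ X → a ∷ b ∷ X) (List.++-identityʳ Q)))) δ₁)
  ... | _ , []        , _ , _ , ()
  ... | _ , _ ∷ _ ∷ _ , _ , _ , ()

  no-triangle-EF : NoTriangle n τE τF
  no-triangle-EF {[]} δ with IsBlockTransposition-length δ
  ... | ()
  no-triangle-EF {_ ∷ []} δ with IsBlockTransposition-length δ
  ... | ()
  no-triangle-EF {a ∷ b ∷ Q} δ δ₁ δ₂ =
    slide-impossible Q a b (2≤k Q |Q|)
      (subst (IsBlockTransposition n)
        (trans (cong₂ _⊚_ d≡ τE≡) (⊚-swap [] (a ∷ b ∷ []) Q [] refl refl |Q| refl)) δ₁)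
      (subst (IsBlockTransposition n)
        (trans (cong₂ _⊚_ d≡ τF≡) (⊚-swap (a ∷ []) (b ∷ []) Q [] refl refl |Q| refl)) δ₂)
      δ
    where
    |Q| : length Q ≡ k
    |Q| = ℕ.suc-injective (ℕ.suc-injective (IsBlockTransposition-length δ))
    d≡ : a ∷ b ∷ Q ≡ a ∷ b ∷ Q ++ []
    d≡ = cong (λ X → a ∷ b ∷ X) (sym (List.++-identityʳ Q))

  facts-AB : EdgeFacts n k (τA , τB)
  facts-AB = ((τA∈T , τB∈T , τC , τC∈T , τB≡τA⊚τC) , no-common-neighbour no-triangle-AB)
           , cong (edgeIndex n) (decode-σ 0<k k<1+k 1+k≤n) , cong (edgeIndex n) (decode-σ 0<k k<n ℕ.≤-refl)

  facts-CD : EdgeFacts n (suc k) (τC , τD)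
  facts-CD = ((τC∈T , τD∈T , τE , τE∈T , τD≡τC⊚τE) , no-common-neighbour no-triangle-CD)
           , cong (edgeIndex n) (decode-σ 1<1+k 1+k<n ℕ.≤-refl) , cong (edgeIndex n) (decode-σ 0<1 1<1+k 1+k≤n)

  facts-EF : EdgeFacts n n (τE , τF)
  facts-EF = ((τE∈T , τF∈T , τA , τA∈T , τF≡τE⊚τA) , no-common-neighbour no-triangle-EF)
           , cong (edgeIndex n) (decode-σ 0<2 2<n ℕ.≤-refl) , cong (edgeIndex n) (decode-σ 1<2 2<n ℕ.≤-refl)

local-facts : ∀ {n} m t → n ≡ m + 3 + t → EdgeFacts n m (σ n m (m + 1) (m + 3) , σ n m (m + 2) (m + 3))
local-facts m t refl = Local.facts m t

m∸k≡j⇒m≡j+k : ∀ {m k j} → ¬ m < k → m ∸ k ≡ j → m ≡ j + k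
m∸k≡j⇒m≡j+k m≮k eq = trans (sym (ℕ.m∸n+n≡m (ℕ.≮⇒≥ m≮k))) (cong (_+ _) eq)

e-facts : ∀ w m → m ≤ 5 + w → EdgeFacts (5 + w) m (e (5 + w) m)
e-facts w m m≤n with suc m ≤? 3 + w
... | yes m<k = let t , eq = ℕ.m≤n⇒∃[o]m+o≡n m<k in
  local-facts m t (trans (cong (2 +_) (sym eq)) (cong (_+ t) (ℕ.+-comm 3 m)))
... | no m≮k with m ∸ (3 + w) in eq
...   | zero        = subst (λ m → EdgeFacts _ m _) (sym (m∸k≡j⇒m≡j+k m≮k eq)) (End.facts-AB w)
...   | suc zero    = subst (λ m → EdgeFacts _ m _) (sym (m∸k≡j⇒m≡j+k m≮k eq)) (End.facts-CD w)
...   | suc (suc x) = subst (λ m → EdgeFacts _ m _)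
  (ℕ.≤-antisym (subst (5 + w ≤_) (sym (m∸k≡j⇒m≡j+k m≮k eq)) (s≤s (s≤s (ℕ.m≤n+m (3 + w) x)))) m≤n)
  (End.facts-EF w)

indexed⇒disjoint : ∀ {n m m′ p q} → Indexed n m p → Indexed n m′ q → m ≢ m′ → Disjoint p q
indexed⇒disjoint {n} {m} {m′} (i₁ , i₂) (j₁ , j₂) m≢m′ =
  apart i₁ j₁ , apart i₁ j₂ , apart i₂ j₁ , apart i₂ j₂
  where
  apart : ∀ {x y} → edgeIndex n (decode x) ≡ m → edgeIndex n (decode y) ≡ m′ → x ≢ y
  apart iₓ iᵧ refl = m≢m′ (trans (sym iₓ) iᵧ)

proposition5 : (n : ℕ) → 5 ≤ n →
    ((m : ℕ) → m ≤ n →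
      AdjΓ n (proj₁ (e n m)) (proj₂ (e n m))
      × ((c : List ℕ) → InT n c →
          ¬ (AdjΓ n c (proj₁ (e n m)) × AdjΓ n c (proj₂ (e n m)))))
    × ((m m′ : ℕ) → m ≤ n → m′ ≤ n → m ≢ m′ → Disjoint (e n m) (e n m′))
proposition5 n 5≤n with w , refl ← ℕ.m≤n⇒∃[o]m+o≡n 5≤n =
  (λ m m≤n → proj₁ (e-facts w m m≤n)) ,
  (λ m m′ m≤n m′≤n → indexed⇒disjoint (proj₂ (e-facts w m m≤n)) (proj₂ (e-facts w m′ m′≤n)))
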